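{- If $G$ is a connected graph of order $n$ with maximum degree $\Delta(G)=2$ and $\chi_{NL}(G)=k\ge 3$, then $n\le \ell(k)=\frac{k^3-k^2}{2}$.
   Context: All graphs are finite, simple, undirected and connected. A $k$-coloring of a graph $G$ is a partition of $V(G)$ into $k$ independent sets (colors). A coloring $\{S_1,\dots,S_k\}$ is neighbor-locating (an NL-coloring) if for any two distinct vertices $u,v$ in the same color class, $\{j: N(u)\cap S_j\neq\emptyset\}\neq\{j: N(v)\cap S_j\neq\emptyset\}$. The neighbor-locating chromatic number $\chi_{NL}(G)$ is the minimum number of colors in an NL-coloring of $G$. -}

module Defs where

open import Data.Nat using (ℕ; zero; suc; _+_; _≤_; _<_)
open import Data.Fin using (Fin)
open import Data.Bool using (Bool; true; false; if_then_else_)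
open import Data.List using (List; map; allFin)
open import Data.Nat.ListAction using (sum)
open import Data.Product using (Σ; _×_; ∃)
open import Relation.Binary.PropositionalEquality using (_≡_; _≢_)
open import Relation.Nullary using (¬_)
open import Function.Bundles using (_⇔_)
open import Level using (0ℓ)

record Graph (n : ℕ) : Set where
  field
    adj     : Fin n → Fin n → Bool
    symm    : ∀ u v → adj u v ≡ adj v u
    irrefl  : ∀ v → adj v v ≡ false
open Graph public

degree : ∀ {n} → Graph n → Fin n → ℕ
degree {n} G v = sum (map (λ w → if adj G v w then 1 else 0) (allFin n))

MaxDegreeIs : ∀ {n} → Graph n → ℕ → Set
MaxDegreeIs {n} G d = (∀ v → degree G v ≤ d) × (Σ (Fin n) λ v → degree G v ≡ d)

data Reach {n} (G : Graph n) : Fin n → Fin n → Set where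
  here : ∀ {u} → Reach G u u
  step : ∀ {u v w} → adj G u v ≡ true → Reach G v w → Reach G u w

Connected : ∀ {n} → Graph n → Set
Connected {n} G = ∀ (u v : Fin n) → Reach G u v

-- a k-coloring: a partition of V(G) into k (nonempty) independent sets,
-- represented by a surjective map to Fin k that is proper
record Coloring {n} (G : Graph n) (k : ℕ) : Set where
  field
    col    : Fin n → Fin k
    proper : ∀ u v → adj G u v ≡ true → col u ≢ col v
    onto   : ∀ (j : Fin k) → Σ (Fin n) λ v → col v ≡ j
open Coloring public

NbHasColor : ∀ {n k} {G : Graph n} → Coloring G k → Fin n → Fin k → Set
NbHasColor {G = G} c u j = ∃ λ w → adj G u w ≡ true × col c w ≡ j

NeighborLocating : ∀ {n k} {G : Graph n} → Coloring G k → Set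
NeighborLocating {n} c = ∀ (u v : Fin n) → u ≢ v → col c u ≡ col c v →
  ¬ (∀ j → NbHasColor c u j ⇔ NbHasColor c v j)

χNL≡ : ∀ {n} → Graph n → ℕ → Set
χNL≡ G k = (Σ (Coloring G k) NeighborLocating)
         × (∀ m → m < k → (c : Coloring G m) → ¬ NeighborLocating c)

module Submission where

-- Let c be a neighbor-locating k-colouring.  Every vertex u has a neighbour
-- (G is connected and not a single vertex) and at most two, so the set of
-- colours seen in N(u) is {x, y} ∖ {c(u)} for two distinct colours x < y:
-- when N(u) shows two colours they are x and y, and when it shows a single
-- colour a, the pair {c(u), a} works.  Call (x, y) the palette of u.  Since c
-- is neighbor-locating, u is determined by c(u) together with its palette,
-- so the vertices inject into the triples (colour, x, y) with x < y, of
-- which there are k · k(k−1)/2 = (k³ − k²)/2.  To avoid halving we count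
-- each vertex twice, once with (x, y) and once with (y, x), which injects
-- two copies of the vertex set into k · k(k−1) codes.

open import Defs
open import Data.Nat using (ℕ; zero; suc; _+_; _*_; _^_; _∸_; _≤_; _<_; z≤n; s≤s)
import Data.Nat.Properties as ℕ
open import Data.Nat.Tactic.RingSolver using (solve-∀)
open import Data.Nat.ListAction using (sum)
open import Data.Fin as Fin using (Fin; punchIn; punchOut; combine; splitAt; join)
  renaming (zero to fzero; suc to fsuc)
import Data.Fin.Properties as Finₚ
open import Data.Bool using (true; if_then_else_) renaming (_≟_ to _≟ᵇ_)
open import Data.List using (tabulate)
open import Data.List.Properties using (map-tabulate)
open import Data.Product using (∃; _×_; _,_; map₁)
open import Data.Sum using (_⊎_; inj₁; inj₂; [_,_]′; swap)
open import Data.Empty using (⊥; ⊥-elim)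
open import Relation.Binary.PropositionalEquality
open import Relation.Binary.Definitions using (tri<; tri≈; tri>)
open import Relation.Nullary using (¬_; yes; no)
open import Relation.Nullary.Decidable using (_×-dec_; ¬?)
open import Function using (_∘_; id)
open import Function.Bundles using (_⇔_; mk⇔)
open import Function.Construct.Identity using (⇔-id)
open import Function.Construct.Composition using (_⇔-∘_)
open import Function.Construct.Symmetry using (⇔-sym)
open import Algebra.Properties.CommutativeSemigroup ℕ.+-commutativeSemigroup
  using (x∙yz≈y∙xz)

total : ∀ {n} → (Fin n → ℕ) → ℕ
total g = sum (tabulate g)

total-punchIn : ∀ {n} (g : Fin (suc n) → ℕ) i → total g ≡ g i + total (g ∘ punchIn i)
total-punchIn g fzero = refl
total-punchIn {zero} g (fsuc ())
total-punchIn {suc n} g (fsuc i) = begin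
  g fzero + total (g ∘ fsuc)
    ≡⟨ cong (g fzero +_) (total-punchIn (g ∘ fsuc) i) ⟩
  g fzero + (g (fsuc i) + total (g ∘ fsuc ∘ punchIn i))
    ≡⟨ x∙yz≈y∙xz (g fzero) (g (fsuc i)) _ ⟩
  g (fsuc i) + total (g ∘ punchIn (fsuc i))
    ∎
  where open ≡-Reasoning

term≤total : ∀ {n} (g : Fin n → ℕ) i → g i ≤ total g
term≤total {suc n} g i = subst (g i ≤_) (sym (total-punchIn g i)) (ℕ.m≤m+n _ _)

two-terms≤total : ∀ {n} (g : Fin n → ℕ) {a b} → a ≢ b → g a + g b ≤ total g
two-terms≤total {suc n} g {a} {b} a≢b = begin
  g a + g b                            ≡⟨ cong (λ i → g a + g i) (sym (Finₚ.punchIn-punchOut a≢b)) ⟩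
  g a + (g ∘ punchIn a) (punchOut a≢b) ≤⟨ ℕ.+-monoʳ-≤ (g a) (term≤total (g ∘ punchIn a) _) ⟩
  g a + total (g ∘ punchIn a)          ≡⟨ sym (total-punchIn g a) ⟩
  total g                              ∎
  where open ℕ.≤-Reasoning

three-terms≤total : ∀ {n} (g : Fin n → ℕ) {a b c} → a ≢ b → a ≢ c → b ≢ c →
                    g a + g b + g c ≤ total g
three-terms≤total {suc n} g {a} {b} {c} a≢b a≢c b≢c = begin
  g a + g b + g c
    ≡⟨ ℕ.+-assoc (g a) (g b) (g c) ⟩
  g a + (g b + g c)
    ≡⟨ cong₂ (λ i j → g a + (g i + g j)) (sym (Finₚ.punchIn-punchOut a≢b))
                                          (sym (Finₚ.punchIn-punchOut a≢c)) ⟩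
  g a + (g (punchIn a (punchOut a≢b)) + g (punchIn a (punchOut a≢c)))
    ≤⟨ ℕ.+-monoʳ-≤ (g a) (two-terms≤total (g ∘ punchIn a) b′≢c′) ⟩
  g a + total (g ∘ punchIn a)
    ≡⟨ sym (total-punchIn g a) ⟩
  total g
    ∎
  where
  open ℕ.≤-Reasoning
  b′≢c′ : punchOut a≢b ≢ punchOut a≢c
  b′≢c′ = b≢c ∘ Finₚ.punchOut-injective a≢b a≢c

positive-term : ∀ {n} (g : Fin n → ℕ) → 0 < total g → ∃ λ i → 0 < g i
positive-term {suc n} g pos with g fzero in g₀≡
... | suc _ = fzero , subst (0 <_) (sym g₀≡) (s≤s z≤n)
... | zero  with positive-term (g ∘ fsuc) pos
...   | i , gᵢ>0 = fsuc i , gᵢ>0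

module _ {n} (G : Graph n) where

  HasNeighbour : Fin n → Set
  HasNeighbour v = ∃ λ w → adj G v w ≡ true

  edge? : Fin n → Fin n → ℕ
  edge? v w = if adj G v w then 1 else 0

  degree≡total : ∀ v → degree G v ≡ total (edge? v)
  degree≡total v = cong sum (map-tabulate id (edge? v))

  edge?-adj : ∀ {v w} → adj G v w ≡ true → edge? v w ≡ 1
  edge?-adj e rewrite e = refl

  three-neighbours : ∀ {v a b c} → adj G v a ≡ true → adj G v b ≡ true → adj G v c ≡ true →
                     a ≢ b → a ≢ c → b ≢ c → 3 ≤ degree G v
  three-neighbours {v} va vb vc a≢b a≢c b≢c =
    subst₂ _≤_ (cong₂ _+_ (cong₂ _+_ (edge?-adj va) (edge?-adj vb)) (edge?-adj vc))
               (sym (degree≡total v))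
               (three-terms≤total (edge? v) a≢b a≢c b≢c)

  positive-degree : ∀ {v} → 0 < degree G v → HasNeighbour v
  positive-degree {v} pos with positive-term (edge? v) (subst (0 <_) (degree≡total v) pos)
  ... | w , edge>0 with adj G v w in e
  ...   | true = w , e   -- if adj G v w were false, edge>0 would read 0 < 0

  no-isolated : Connected G → ∀ {v₀} → HasNeighbour v₀ → ∀ u → HasNeighbour u
  no-isolated conn {v₀} v₀-nb u with conn u v₀
  ... | here         = v₀-nb
  ... | step uw _    = _ , uw

Allowed : ∀ {k} → Fin k → Fin k → Fin k → Fin k → Set
Allowed x y c j = (j ≡ x ⊎ j ≡ y) × j ≢ c

Allowed-swap : ∀ {k} {x y c j : Fin k} → Allowed x y c j ⇔ Allowed y x c j
Allowed-swap = mk⇔ (map₁ swap) (map₁ swap)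

Allowed-cong : ∀ {k} {x x′ y y′ c c′ j : Fin k} →
               x ≡ x′ → y ≡ y′ → c ≡ c′ → Allowed x y c j ⇔ Allowed x′ y′ c′ j
Allowed-cong refl refl refl = ⇔-id _

record Palette {n k} {G : Graph n} (c : Coloring G k) (u : Fin n) : Set where
  field
    lo hi     : Fin k
    lo<hi     : lo Fin.< hi
    nbColours : ∀ j → NbHasColor c u j ⇔ Allowed lo hi (col c u) j
open Palette

module _ {n k} {G : Graph n} (c : Coloring G k) where

  sortPalette : ∀ {u x y} → x ≢ y → (∀ j → NbHasColor c u j ⇔ Allowed x y (col c u) j) →
                Palette c u
  sortPalette {x = x} {y} x≢y spec with Finₚ.<-cmp x y
  ... | tri< x<y _ _ = record { lo = x ; hi = y ; lo<hi = x<y ; nbColours = spec }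
  ... | tri≈ _ x≡y _ = ⊥-elim (x≢y x≡y)
  ... | tri> _ _ y<x = record { lo = y ; hi = x ; lo<hi = y<x
                              ; nbColours = λ j → Allowed-swap ⇔-∘ spec j }

  nbColour≢own : ∀ {u j} → NbHasColor c u j → j ≢ col c u
  nbColour≢own {u} (z , uz , cz≡j) j≡cu = proper c u z uz (sym (trans cz≡j j≡cu))

  module _ (deg≤2 : ∀ v → degree G v ≤ 2) where

    -- Two neighbours of different colours: since deg u ≤ 2 they are all of
    -- N(u), so N(u) shows exactly their two colours.
    twoColours : ∀ {u w₁ w₂} → adj G u w₁ ≡ true → adj G u w₂ ≡ true → col c w₁ ≢ col c w₂ →
                 ∀ j → NbHasColor c u j ⇔ Allowed (col c w₁) (col c w₂) (col c u) j
    twoColours {u} {w₁} {w₂} uw₁ uw₂ c₁≢c₂ j = mk⇔ to from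
      where
      to : NbHasColor c u j → Allowed (col c w₁) (col c w₂) (col c u) j
      to nb@(z , uz , cz≡j) with z Finₚ.≟ w₁ | z Finₚ.≟ w₂
      ... | yes z≡w₁ | _       = inj₁ (trans (sym cz≡j) (cong (col c) z≡w₁)) , nbColour≢own nb
      ... | no _     | yes z≡w₂ = inj₂ (trans (sym cz≡j) (cong (col c) z≡w₂)) , nbColour≢own nb
      ... | no z≢w₁  | no z≢w₂  = ⊥-elim (ℕ.≤⇒≯ (deg≤2 u)
              (three-neighbours G uz uw₁ uw₂ z≢w₁ z≢w₂ (c₁≢c₂ ∘ cong (col c))))
      from : Allowed (col c w₁) (col c w₂) (col c u) j → NbHasColor c u j
      from (inj₁ j≡c₁ , _) = w₁ , uw₁ , sym j≡c₁
      from (inj₂ j≡c₂ , _) = w₂ , uw₂ , sym j≡c₂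

    oneColour : ∀ {u w₁} → adj G u w₁ ≡ true →
                ¬ (∃ λ w → adj G u w ≡ true × col c w ≢ col c w₁) →
                ∀ j → NbHasColor c u j ⇔ Allowed (col c u) (col c w₁) (col c u) j
    oneColour {u} {w₁} uw₁ no-other j = mk⇔ to from
      where
      to : NbHasColor c u j → Allowed (col c u) (col c w₁) (col c u) j
      to nb@(z , uz , cz≡j) with col c z Finₚ.≟ col c w₁
      ... | yes cz≡c₁ = inj₂ (trans (sym cz≡j) cz≡c₁) , nbColour≢own nb
      ... | no cz≢c₁  = ⊥-elim (no-other (z , uz , cz≢c₁))
      from : Allowed (col c u) (col c w₁) (col c u) j → NbHasColor c u j
      from (inj₁ j≡cu , j≢cu) = ⊥-elim (j≢cu j≡cu)
      from (inj₂ j≡c₁ , _)    = w₁ , uw₁ , sym j≡c₁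

    palette : ∀ u → HasNeighbour G u → Palette c u
    palette u (w₁ , uw₁)
      with Finₚ.any? (λ w → (adj G u w ≟ᵇ true) ×-dec ¬? (col c w Finₚ.≟ col c w₁))
    ... | yes (w₂ , uw₂ , c₂≢c₁) = sortPalette (c₂≢c₁ ∘ sym) (twoColours uw₁ uw₂ (c₂≢c₁ ∘ sym))
    ... | no no-other            = sortPalette (proper c u w₁ uw₁) (oneColour uw₁ no-other)

  -- In a neighbor-locating colouring a vertex is determined by its colour
  -- and its palette, as both together determine the colours seen in N(u).
  palette-determines-vertex : NeighborLocating c → (pal : ∀ u → Palette c u) →
    ∀ {u v} → col c u ≡ col c v → lo (pal u) ≡ lo (pal v) → hi (pal u) ≡ hi (pal v) → u ≡ v
  palette-determines-vertex nl pal {u} {v} cu≡cv lo≡ hi≡ with u Finₚ.≟ v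
  ... | yes u≡v = u≡v
  ... | no u≢v  = ⊥-elim (nl u v u≢v cu≡cv sameColours)
    where
    sameColours : ∀ j → NbHasColor c u j ⇔ NbHasColor c v j
    sameColours j = ⇔-sym (nbColours (pal v) j)
                    ⇔-∘ (Allowed-cong lo≡ hi≡ cu≡cv ⇔-∘ nbColours (pal u) j)

codePair : ∀ {k} {x y : Fin (suc k)} → x ≢ y → Fin (suc k * k)
codePair {x = x} x≢y = combine x (punchOut x≢y)

codePair-injective : ∀ {k} {x y x′ y′ : Fin (suc k)} (p : x ≢ y) (p′ : x′ ≢ y′) →
                     codePair p ≡ codePair p′ → x ≡ x′ × y ≡ y′
codePair-injective {x = x} {x′ = x′} p p′ eq
  with Finₚ.combine-injective x (punchOut p) x′ (punchOut p′) eq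
... | refl , out≡ = refl , Finₚ.punchOut-injective p p′ out≡

splitAt-injective : ∀ m {n} {i j : Fin (m + n)} → splitAt m i ≡ splitAt m j → i ≡ j
splitAt-injective m {n} {i} {j} eq =
  trans (sym (Finₚ.join-splitAt m n i)) (trans (cong (join m n) eq) (Finₚ.join-splitAt m n j))

-- The copy inj₁ u is
-- coded by (a u, lo u, hi u) and inj₂ u by (a u, hi u, lo u); the order of the
-- pair tells the copies apart.
sortedLabels-bound : ∀ {n m k} (a : Fin n → Fin m) (lo hi : Fin n → Fin (suc k)) →
  (∀ u → lo u Fin.< hi u) →
  (∀ {u v} → a u ≡ a v → lo u ≡ lo v → hi u ≡ hi v → u ≡ v) →
  n + n ≤ m * (suc k * k)
sortedLabels-bound {n} {m} {k} a lo hi lo<hi determined =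
  Finₚ.injective⇒≤ (splitAt-injective n ∘ code-injective)
  where
  vertex : Fin n ⊎ Fin n → Fin n
  vertex = [ id , id ]′

  first second : Fin n ⊎ Fin n → Fin (suc k)
  first  = [ lo , hi ]′
  second = [ hi , lo ]′

  first≢second : ∀ s → first s ≢ second s
  first≢second (inj₁ u) = Finₚ.<⇒≢ (lo<hi u)
  first≢second (inj₂ u) = Finₚ.<⇒≢ (lo<hi u) ∘ sym

  code : Fin n ⊎ Fin n → Fin (m * (suc k * k))
  code s = combine (a (vertex s)) (codePair (first≢second s))

  uncrossed : ∀ u v → lo u ≡ hi v → hi u ≡ lo v → ⊥
  uncrossed u v lo≡hi hi≡lo = Finₚ.<-asym (lo<hi u) (subst₂ Fin._<_ (sym hi≡lo) (sym lo≡hi) (lo<hi v))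

  recover : ∀ s t → a (vertex s) ≡ a (vertex t) → first s ≡ first t → second s ≡ second t → s ≡ t
  recover (inj₁ u) (inj₁ v) a≡ lo≡ hi≡ = cong inj₁ (determined a≡ lo≡ hi≡)
  recover (inj₂ u) (inj₂ v) a≡ hi≡ lo≡ = cong inj₂ (determined a≡ lo≡ hi≡)
  recover (inj₁ u) (inj₂ v) _ lo≡hi hi≡lo = ⊥-elim (uncrossed u v lo≡hi hi≡lo)
  recover (inj₂ u) (inj₁ v) _ hi≡lo lo≡hi = ⊥-elim (uncrossed u v lo≡hi hi≡lo)

  code-injective : ∀ {s t} → code s ≡ code t → s ≡ t
  code-injective {s} {t} eq with Finₚ.combine-injective _ _ _ _ eq
  ... | a≡ , pair≡ with codePair-injective (first≢second s) (first≢second t) pair≡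
  ...   | first≡ , second≡ = recover s t a≡ first≡ second≡

-- (k+1)³ = (k+1)²·k + (k+1)², with the powers unfolded as `_^_` computes them.
cube-expand : ∀ k → (1 + k) * ((1 + k) * ((1 + k) * 1)) ≡ (1 + k) * ((1 + k) * k) + (1 + k) * ((1 + k) * 1)
cube-expand = solve-∀

cube∸square : ∀ k → suc k ^ 3 ∸ suc k ^ 2 ≡ suc k * (suc k * k)
cube∸square k = begin
  suc k ^ 3 ∸ suc k ^ 2                       ≡⟨ cong (_∸ suc k ^ 2) (cube-expand k) ⟩
  suc k * (suc k * k) + suc k ^ 2 ∸ suc k ^ 2 ≡⟨ ℕ.m+n∸n≡m _ (suc k ^ 2) ⟩
  suc k * (suc k * k)                         ∎
  where open ≡-Reasoning

proposition3 : ∀ (n k : ℕ) (G : Graph n) → Connected G → MaxDegreeIs G 2 →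
    χNL≡ G k → 3 ≤ k → 2 * n ≤ k ^ 3 ∸ k ^ 2
proposition3 n zero    G _ _ _ ()
proposition3 n (suc k) G conn (deg≤2 , v₀ , deg-v₀) ((c , nl) , _) _ =
  subst₂ _≤_ (cong (n +_) (sym (ℕ.+-identityʳ n))) (sym (cube∸square k))
    (sortedLabels-bound (col c) (lo ∘ pal) (hi ∘ pal) (lo<hi ∘ pal)
                        (palette-determines-vertex c nl pal))
  where
  v₀-nb : HasNeighbour G v₀
  v₀-nb = positive-degree G (subst (0 <_) (sym deg-v₀) (s≤s z≤n))

  pal : ∀ u → Palette c u
  pal u = palette c deg≤2 u (no-isolated G conn v₀-nb u)
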